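{- Let $\alpha$ be a nondegenerate simplex in the $d$-cube and fix an exterior $d'$-face $\sigma$ of $\alpha$. Then every exterior $d'$-face $\tau$ of $\alpha$ is uniquely determined by its footprint-shadow pair $(\tau\cap\sigma,\ \pi_\sigma(\tau))$ with respect to $\sigma$; that is, distinct exterior $d'$-faces of $\alpha$ have distinct footprint-shadow pairs.
   Context: A nondegenerate $d$-simplex in the $d$-cube is the convex hull of $d+1$ affinely independent points of $\{0,1\}^d$. A $j$-face of the cube $[0,1]^d$ is obtained by fixing $d-j$ specified coordinates to specified values in $\{0,1\}$. A $j$-face of a simplex is the convex hull of $j+1$ of its vertices; it is exterior if it is contained in some $j$-face of the cube. For an exterior face $\sigma$, let $S_\sigma$ be the set of coordinates on which the vertices of $\sigma$ are not all equal, and let $\pi_\sigma:[0,1]^d\to[0,1]^d$ replace each coordinate with index in $S_\sigma$ by $0$. The footprint of $\tau$ with respect to $\sigma$ is $\tau\cap\sigma$ (possibly empty) and the shadow of $\tau$ with respect to $\sigma$ is $\pi_\sigma(\tau)$.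
   Formalization: Points of the cube have rational coordinates and convex combinations have rational coefficients, so convex hulls, affine independence, footprints and shadows are taken over ℚ. -}

module Defs where

open import Data.Nat using (ℕ; zero; suc; _∸_)
open import Data.Bool using (Bool; true; false; if_then_else_)
open import Data.Fin using (Fin; zero; suc)
open import Data.Fin.Subset using (Subset; _∈_; _∉_; ∣_∣)
open import Data.Rational using (ℚ; 0ℚ; 1ℚ; _+_; _*_; _≤_)
open import Data.Product using (Σ; _×_; ∃)
open import Relation.Binary.PropositionalEquality using (_≡_; _≢_)
open import Relation.Nullary using (¬_)

Point : ℕ → Set
Point d = Fin d → ℚ

CubeVertex : ℕ → Set
CubeVertex d = Fin d → Bool

bℚ : Bool → ℚ
bℚ b = if b then 1ℚ else 0ℚ

embed : ∀ {d} → CubeVertex d → Point d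
embed v k = bℚ (v k)

sumℚ : ∀ {m} → (Fin m → ℚ) → ℚ
sumℚ {zero}  f = 0ℚ
sumℚ {suc m} f = f zero + sumℚ (λ i → f (suc i))

AffinelyIndependent : ∀ {m d} → (Fin m → Point d) → Set
AffinelyIndependent {m} {d} p =
  (c : Fin m → ℚ) → sumℚ c ≡ 0ℚ →
  (∀ k → sumℚ (λ i → c i * p i k) ≡ 0ℚ) → ∀ i → c i ≡ 0ℚ

InHull : ∀ {m d} → (Fin m → Point d) → Subset m → Point d → Set
InHull {m} p F x =
  Σ (Fin m → ℚ) λ c →
    (∀ i → 0ℚ ≤ c i) × (∀ i → i ∉ F → c i ≡ 0ℚ) × (sumℚ c ≡ 1ℚ) ×
    (∀ k → x k ≡ sumℚ (λ i → c i * p i k))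

record Simplex (d : ℕ) : Set where
  field
    vert   : Fin (suc d) → CubeVertex d
    affind : AffinelyIndependent (λ i → embed (vert i))
open Simplex public

vpts : ∀ {d} → Simplex d → Fin (suc d) → Point d
vpts α i = embed (vert α i)

-- the j-face of the cube obtained by fixing the coordinates in C to the values b
InCubeFace : ∀ {d} → Subset d → CubeVertex d → Point d → Set
InCubeFace {d} C b x = (∀ k → 0ℚ ≤ x k × x k ≤ 1ℚ) × (∀ k → k ∈ C → x k ≡ bℚ (b k))

ExteriorFace : ∀ {d} → Simplex d → ℕ → Subset (suc d) → Set
ExteriorFace {d} α j F =
  (∣ F ∣ ≡ suc j) ×
  Σ (Subset d) λ C → Σ (CubeVertex d) λ b →
    (∣ C ∣ ≡ d ∸ j) × (∀ x → InHull (vpts α) F x → InCubeFace C b x)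

InS : ∀ {d} → Simplex d → Subset (suc d) → Fin d → Set
InS α σ k = Σ _ λ i → Σ _ λ i' → i ∈ σ × i' ∈ σ × vert α i k ≢ vert α i' k

IsProj : ∀ {d} → Simplex d → Subset (suc d) → Point d → Point d → Set
IsProj α σ x y = ∀ k → (InS α σ k → y k ≡ 0ℚ) × (¬ InS α σ k → y k ≡ x k)

Footprint : ∀ {d} → Simplex d → (σ τ : Subset (suc d)) → Point d → Set
Footprint α σ τ x = InHull (vpts α) τ x × InHull (vpts α) σ x

Shadow : ∀ {d} → Simplex d → (σ τ : Subset (suc d)) → Point d → Set
Shadow α σ τ y = Σ _ λ x → InHull (vpts α) τ x × IsProj α σ x y

SameSet : ∀ {d} → (Point d → Set) → (Point d → Set) → Set
SameSet A B = (∀ x → A x → B x) × (∀ x → B x → A x)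

-- A vertex of τ lying in σ is a point of the footprint, and an affinely independent
-- family has no vertex in the convex hull of the other vertices, so it is a vertex of τ'.
-- For a vertex vᵢ of τ outside σ, let σ lie in the cube face x_k = b_k (k ∈ C) of
-- dimension d'. The coordinates in C are constant on σ, so π_σ keeps them, and the shadow
-- point π_σ(vᵢ) is the projection of some x' in the hull of τ' that agrees with vᵢ on C.
-- Since these coordinates are 0/1, every vertex vⱼ of τ' with positive weight in x' agrees
-- with vᵢ on C. If j ≠ i, then vᵢ - vⱼ and the edge vectors of σ would be d' + 1 vectors
-- vanishing on C, hence linearly dependent in the d' remaining coordinates, which gives an
-- affine dependence among the vertices of α. So j = i is a vertex of τ'.

{-# OPTIONS --safe #-}
module Submission where

open import Defs
open import Algebra.Bundles using (CommutativeRing)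
open import Data.Bool using (Bool; true; false; not; _xor_; if_then_else_)
open import Data.Bool.Properties using () renaming (_≟_ to _≟𝔹_)
open import Data.Empty using (⊥-elim)
open import Data.Fin using (Fin; zero; suc; _≟_)
open import Data.Fin.Properties using (any?; ¬∀⟶∃¬)
open import Data.Fin.Subset
  using (Subset; _∈_; _∉_; _⊆_; _∪_; _─_; ∁; ⁅_⁆; ∣_∣; Nonempty; inside; outside)
  renaming (_-_ to _∖_)
open import Data.Fin.Subset.Properties
  using (_∈?_; nonempty?; Empty-unique; ⊆-antisym; p⊆q⇒∣p∣≤∣q∣; ∣p∣≤n; ∣⊥∣≡0; ∣∁p∣≡n∸∣p∣; x∉∁p⇒x∈p
        ; x∈⁅x⁆; x∈⁅y⁆⇒x≡y; x∈p∪q⁺; x∈p∪q⁻; p─⊥≡p; p─q⊆p; x∈p∧x≢y⇒x∈p-y)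
open import Data.Nat as ℕ using (ℕ; zero; suc; _<_)
open import Data.Nat.Properties
  using (<-irrefl; <-trans; ≤-<-trans; <-≤-trans; n<1+n; ≤-pred; suc-injective; m∸[m∸n]≡n)
  renaming (≤-trans to ≤ℕ-trans; ≤-reflexive to ≤ℕ-reflexive)
open import Data.Product using (∃; ∃₂; _×_; _,_; proj₁; proj₂)
open import Data.Rational using (ℚ; 0ℚ; 1ℚ; _+_; _*_; _-_; _≤_; 1/_; NonZero; ≢-nonZero)
open import Data.Rational.Properties
  using (+-*-commutativeRing; +-0-group; 1≢0; ≤-refl; ≤-antisym; nonNegative⁻¹; +-mono-≤; +-monoˡ-≤; +-monoʳ-≤
        ; +-identityˡ; +-identityʳ; +-inverseʳ; *-identityˡ; *-identityʳ; *-zeroˡ; *-zeroʳ; *-assoc; *-inverseˡ)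
  renaming (_≟_ to _≟ℚ_)
open import Data.Rational.Solver using (module +-*-Solver)
open import Data.Sum using (inj₁; inj₂)
open import Data.Vec using (_∷_; here; there)
open import Function using (_∘_)
open import Relation.Binary.PropositionalEquality
open import Relation.Nullary using (¬_; Dec; yes; no; does; ¬?; _×-dec_)
open import Relation.Nullary.Decidable using (decidable-stable)

open import Algebra.Properties.Semiring.Sum (CommutativeRing.semiring +-*-commutativeRing)
  using (sum; sum-cong-≗; sum-replicate-zero; ∑-comm; *-distribˡ-sum; *-distribʳ-sum)
open import Algebra.Properties.Group +-0-group using (x∙y⁻¹≈ε⇒x≈y; x≈y⇒x∙y⁻¹≈ε)
open +-*-Solver using (solve; _:=_; _:+_; _:*_; _:-_; con)
open ≡-Reasoning

sumℚ≡sum : ∀ {m} (f : Fin m → ℚ) → sumℚ f ≡ sum f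
sumℚ≡sum {zero}  f = refl
sumℚ≡sum {suc m} f = cong (f zero +_) (sumℚ≡sum (f ∘ suc))

sum-zero : ∀ {m} {f : Fin m → ℚ} → (∀ i → f i ≡ 0ℚ) → sum f ≡ 0ℚ
sum-zero {m} f≗0 = trans (sum-cong-≗ f≗0) (sum-replicate-zero m)

sum-sub : ∀ {m} (f g : Fin m → ℚ) → sum (λ i → f i - g i) ≡ sum f - sum g
sum-sub {zero}  f g = refl
sum-sub {suc m} f g = begin
  f zero - g zero + sum (λ i → f (suc i) - g (suc i))  ≡⟨ cong (f zero - g zero +_) (sum-sub (f ∘ suc) (g ∘ suc)) ⟩
  f zero - g zero + (sum (f ∘ suc) - sum (g ∘ suc))    ≡⟨ interchange (f zero) (g zero) (sum (f ∘ suc)) (sum (g ∘ suc)) ⟩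
  f zero + sum (f ∘ suc) - (g zero + sum (g ∘ suc))    ∎
  where
  interchange : ∀ a b c d → a - b + (c - d) ≡ a + c - (b + d)
  interchange = solve 4 (λ a b c d → a :- b :+ (c :- d) := a :+ c :- (b :+ d)) refl

sum-sub-* : ∀ {m} (f g : Fin m → ℚ) (a : ℚ) → sum (λ i → f i - g i * a) ≡ sum f - sum g * a
sum-sub-* f g a = trans (sum-sub f (λ i → g i * a)) (cong (sum f -_) (sym (*-distribʳ-sum a g)))

sum-nonneg : ∀ {m} {f : Fin m → ℚ} → (∀ i → 0ℚ ≤ f i) → 0ℚ ≤ sum f
sum-nonneg {zero}  f≥0 = ≤-refl
sum-nonneg {suc m} f≥0 = +-mono-≤ (f≥0 zero) (sum-nonneg (f≥0 ∘ suc))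

nonneg+nonneg≡0 : ∀ {a b} → 0ℚ ≤ a → 0ℚ ≤ b → a + b ≡ 0ℚ → a ≡ 0ℚ × b ≡ 0ℚ
nonneg+nonneg≡0 {a} {b} a≥0 b≥0 a+b≡0 =
  ≤-antisym (subst₂ _≤_ (+-identityʳ a) a+b≡0 (+-monoʳ-≤ a b≥0)) a≥0 ,
  ≤-antisym (subst₂ _≤_ (+-identityˡ b) a+b≡0 (+-monoˡ-≤ b a≥0)) b≥0

nonneg-sum≡0 : ∀ {m} {f : Fin m → ℚ} → (∀ i → 0ℚ ≤ f i) → sum f ≡ 0ℚ → ∀ i → f i ≡ 0ℚ
nonneg-sum≡0 f≥0 Σ≡0 zero    = proj₁ (nonneg+nonneg≡0 (f≥0 zero) (sum-nonneg (f≥0 ∘ suc)) Σ≡0)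
nonneg-sum≡0 f≥0 Σ≡0 (suc i) = nonneg-sum≡0 (f≥0 ∘ suc) Σtail≡0 i
  where Σtail≡0 = proj₂ (nonneg+nonneg≡0 (f≥0 zero) (sum-nonneg (f≥0 ∘ suc)) Σ≡0)

δ : ∀ {m} → Fin m → Fin m → ℚ
δ zero    zero    = 1ℚ
δ zero    (suc _) = 0ℚ
δ (suc _) zero    = 0ℚ
δ (suc i) (suc j) = δ i j

δ-diag : ∀ {m} (i : Fin m) → δ i i ≡ 1ℚ
δ-diag zero    = refl
δ-diag (suc i) = δ-diag i

δ-off : ∀ {m} (i j : Fin m) → i ≢ j → δ i j ≡ 0ℚ
δ-off zero    zero    i≢j = ⊥-elim (i≢j refl)
δ-off zero    (suc j) i≢j = refl
δ-off (suc i) zero    i≢j = refl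
δ-off (suc i) (suc j) i≢j = δ-off i j (i≢j ∘ cong suc)

δ-nonneg : ∀ {m} (i j : Fin m) → 0ℚ ≤ δ i j
δ-nonneg zero    zero    = nonNegative⁻¹ 1ℚ
δ-nonneg zero    (suc j) = ≤-refl
δ-nonneg (suc i) zero    = ≤-refl
δ-nonneg (suc i) (suc j) = δ-nonneg i j

sum-δ-* : ∀ {m} (i : Fin m) (f : Fin m → ℚ) → sum (λ j → δ i j * f j) ≡ f i
sum-δ-* zero f = begin
  1ℚ * f zero + sum (λ j → 0ℚ * f (suc j))  ≡⟨ cong₂ _+_ (*-identityˡ (f zero))
                                                         (sum-zero (λ j → *-zeroˡ (f (suc j)))) ⟩
  f zero + 0ℚ                               ≡⟨ +-identityʳ (f zero) ⟩
  f zero                                    ∎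
sum-δ-* (suc i) f = begin
  0ℚ * f zero + sum (λ j → δ i j * f (suc j))  ≡⟨ cong₂ _+_ (*-zeroˡ (f zero)) (sum-δ-* i (f ∘ suc)) ⟩
  0ℚ + f (suc i)                               ≡⟨ +-identityˡ (f (suc i)) ⟩
  f (suc i)                                    ∎

sum-δ : ∀ {m} (i : Fin m) → sum (δ i) ≡ 1ℚ
sum-δ i = trans (sum-cong-≗ (λ j → sym (*-identityʳ (δ i j)))) (sum-δ-* i (λ _ → 1ℚ))

push : ∀ {m n} → (Fin m → Fin n) → (Fin m → ℚ) → Fin n → ℚ
push ρ c l = sum (λ q → c q * δ (ρ q) l)

sum-push-* : ∀ {m n} (ρ : Fin m → Fin n) (c : Fin m → ℚ) (f : Fin n → ℚ) →
             sum (λ l → push ρ c l * f l) ≡ sum (λ q → c q * f (ρ q))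
sum-push-* ρ c f = begin
  sum (λ l → push ρ c l * f l)                    ≡⟨ sum-cong-≗ (λ l → *-distribʳ-sum (f l) (λ q → c q * δ (ρ q) l)) ⟩
  sum (λ l → sum (λ q → c q * δ (ρ q) l * f l))   ≡⟨ ∑-comm (λ l q → c q * δ (ρ q) l * f l) ⟩
  sum (λ q → sum (λ l → c q * δ (ρ q) l * f l))   ≡⟨ sum-cong-≗ (λ q → factor-out (c q) (ρ q)) ⟩
  sum (λ q → c q * sum (λ l → δ (ρ q) l * f l))   ≡⟨ sum-cong-≗ (λ q → cong (c q *_) (sum-δ-* (ρ q) f)) ⟩
  sum (λ q → c q * f (ρ q))                       ∎
  where
  factor-out : ∀ a i → sum (λ l → a * δ i l * f l) ≡ a * sum (λ l → δ i l * f l)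
  factor-out a i = trans (sum-cong-≗ (λ l → *-assoc a (δ i l) (f l)))
                         (sym (*-distribˡ-sum a (λ l → δ i l * f l)))

sum-push : ∀ {m n} (ρ : Fin m → Fin n) (c : Fin m → ℚ) → sum (push ρ c) ≡ sum c
sum-push ρ c = begin
  sum (push ρ c)                  ≡⟨ sum-cong-≗ (λ l → sym (*-identityʳ (push ρ c l))) ⟩
  sum (λ l → push ρ c l * 1ℚ)     ≡⟨ sum-push-* ρ c (λ _ → 1ℚ) ⟩
  sum (λ q → c q * 1ℚ)            ≡⟨ sum-cong-≗ (λ q → *-identityʳ (c q)) ⟩
  sum c                           ∎

push-outsideImage : ∀ {m n} (ρ : Fin m → Fin n) (c : Fin m → ℚ) {l} → (∀ q → ρ q ≢ l) → push ρ c l ≡ 0ℚ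
push-outsideImage ρ c ρ≢l = sum-zero (λ q → trans (cong (c q *_) (δ-off (ρ q) _ (ρ≢l q))) (*-zeroʳ (c q)))

x∈p─q⇒x∉q : ∀ {n} {x : Fin n} {p q : Subset n} → x ∈ p ─ q → x ∉ q
x∈p─q⇒x∉q {p = inside  ∷ p} () here
x∈p─q⇒x∉q {p = outside ∷ p} () here
x∈p─q⇒x∉q {p = _ ∷ p} {_ ∷ q} (there x∈p─q) (there x∈q) = x∈p─q⇒x∉q x∈p─q x∈q

x∈p∖y⇒x≢y : ∀ {n} {x y : Fin n} {p : Subset n} → x ∈ p ∖ y → x ≢ y
x∈p∖y⇒x≢y {x = x} x∈p∖y refl = x∈p─q⇒x∉q x∈p∖y (x∈⁅x⁆ x)

x∈p⇒∣p∣≡1+∣p∖x∣ : ∀ {n} {x : Fin n} {p : Subset n} → x ∈ p → ∣ p ∣ ≡ suc ∣ p ∖ x ∣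
x∈p⇒∣p∣≡1+∣p∖x∣ {x = zero}  {inside  ∷ p} here        = cong suc (sym (cong ∣_∣ (p─⊥≡p p)))
x∈p⇒∣p∣≡1+∣p∖x∣ {x = suc x} {inside  ∷ p} (there x∈p) = cong suc (x∈p⇒∣p∣≡1+∣p∖x∣ x∈p)
x∈p⇒∣p∣≡1+∣p∖x∣ {x = suc x} {outside ∷ p} (there x∈p) = x∈p⇒∣p∣≡1+∣p∖x∣ x∈p

∣p∣≡0⇒x∉p : ∀ {n} {x : Fin n} {p : Subset n} → ∣ p ∣ ≡ 0 → x ∉ p
∣p∣≡0⇒x∉p ∣p∣≡0 x∈p with trans (sym (x∈p⇒∣p∣≡1+∣p∖x∣ x∈p)) ∣p∣≡0
... | ()

∣p∣>0⇒Nonempty : ∀ {n} (p : Subset n) → 0 < ∣ p ∣ → Nonempty p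
∣p∣>0⇒Nonempty {n} p ∣p∣>0 = decidable-stable (nonempty? p) λ p-empty →
  <-irrefl (sym (trans (cong ∣_∣ (Empty-unique p-empty)) (∣⊥∣≡0 n))) ∣p∣>0

∣p∣≤∣p∪⁅x⁆∖y∣ : ∀ {n} {x y : Fin n} {p : Subset n} → x ∉ p → y ∈ p → ∣ p ∣ ℕ.≤ ∣ (p ∪ ⁅ x ⁆) ∖ y ∣
∣p∣≤∣p∪⁅x⁆∖y∣ {x = x} {y} {p} x∉p y∈p =
  ≤ℕ-trans (p⊆q⇒∣p∣≤∣q∣ p⊆p∪⁅x⁆∖x) (≤ℕ-reflexive (suc-injective 1+∣p∪⁅x⁆∖x∣≡1+∣p∪⁅x⁆∖y∣))
  where
  x∈p∪⁅x⁆ : x ∈ p ∪ ⁅ x ⁆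
  x∈p∪⁅x⁆ = x∈p∪q⁺ (inj₂ (x∈⁅x⁆ x))
  y∈p∪⁅x⁆ : y ∈ p ∪ ⁅ x ⁆
  y∈p∪⁅x⁆ = x∈p∪q⁺ (inj₁ y∈p)
  p⊆p∪⁅x⁆∖x : p ⊆ (p ∪ ⁅ x ⁆) ∖ x
  p⊆p∪⁅x⁆∖x z∈p = x∈p∧x≢y⇒x∈p-y (x∈p∪q⁺ (inj₁ z∈p)) λ { refl → x∉p z∈p }
  1+∣p∪⁅x⁆∖x∣≡1+∣p∪⁅x⁆∖y∣ : suc ∣ (p ∪ ⁅ x ⁆) ∖ x ∣ ≡ suc ∣ (p ∪ ⁅ x ⁆) ∖ y ∣
  1+∣p∪⁅x⁆∖x∣≡1+∣p∪⁅x⁆∖y∣ = trans (sym (x∈p⇒∣p∣≡1+∣p∖x∣ x∈p∪⁅x⁆)) (x∈p⇒∣p∣≡1+∣p∖x∣ y∈p∪⁅x⁆)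

lincomb : ∀ {m d} → (Fin m → ℚ) → (Fin m → Point d) → Point d
lincomb c p k = sum (λ i → c i * p i k)

lincomb-subˡ : ∀ {m d} (c c′ : Fin m → ℚ) (p : Fin m → Point d) k →
  lincomb (λ i → c i - c′ i) p k ≡ lincomb c p k - lincomb c′ p k
lincomb-subˡ c c′ p k = trans
  (sum-cong-≗ (λ i → solve 3 (λ a b x → (a :- b) :* x := a :* x :- b :* x) refl (c i) (c′ i) (p i k)))
  (sum-sub (λ i → c i * p i k) (λ i → c′ i * p i k))

lincomb-subʳ : ∀ {m d} (c : Fin m → ℚ) (p p′ : Fin m → Point d) k →
  lincomb c (λ i k → p i k - p′ i k) k ≡ lincomb c p k - lincomb c p′ k
lincomb-subʳ c p p′ k = trans
  (sum-cong-≗ (λ i → solve 3 (λ a x y → a :* (x :- y) := a :* x :- a :* y) refl (c i) (p i k) (p′ i k)))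
  (sum-sub (λ i → c i * p i k) (λ i → c i * p′ i k))

affineCombination-injective : ∀ {m d} {p : Fin m → Point d} → AffinelyIndependent p →
  ∀ {c c′} → sum c ≡ sum c′ → (∀ k → lincomb c p k ≡ lincomb c′ p k) → ∀ i → c i ≡ c′ i
affineCombination-injective {p = p} indep {c} {c′} Σc≡Σc′ c·p≡c′·p i =
  x∙y⁻¹≈ε⇒x≈y (c i) (c′ i) (indep (λ j → c j - c′ j) Σ≡0 combination≡0 i)
  where
  Σ≡0 : sumℚ (λ j → c j - c′ j) ≡ 0ℚ
  Σ≡0 = begin
    sumℚ (λ j → c j - c′ j)  ≡⟨ sumℚ≡sum (λ j → c j - c′ j) ⟩
    sum (λ j → c j - c′ j)   ≡⟨ sum-sub c c′ ⟩
    sum c - sum c′           ≡⟨ x≈y⇒x∙y⁻¹≈ε Σc≡Σc′ ⟩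
    0ℚ                       ∎
  combination≡0 : ∀ k → sumℚ (λ j → (c j - c′ j) * p j k) ≡ 0ℚ
  combination≡0 k = begin
    sumℚ (λ j → (c j - c′ j) * p j k)    ≡⟨ sumℚ≡sum (λ j → (c j - c′ j) * p j k) ⟩
    lincomb (λ j → c j - c′ j) p k       ≡⟨ lincomb-subˡ c c′ p k ⟩
    lincomb c p k - lincomb c′ p k       ≡⟨ x≈y⇒x∙y⁻¹≈ε (c·p≡c′·p k) ⟩
    0ℚ                                   ∎

vertex∈hull : ∀ {m d} (p : Fin m → Point d) {F : Subset m} {i} → i ∈ F → InHull p F (p i)
vertex∈hull p {i = i} i∈F =
  δ i , δ-nonneg i , (λ j j∉F → δ-off i j λ { refl → j∉F i∈F }) , trans (sumℚ≡sum (δ i)) (sum-δ i) ,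
  λ k → sym (trans (sumℚ≡sum (λ j → δ i j * p j k)) (sum-δ-* i (λ j → p j k)))

vertex∈hull⇒∈ : ∀ {m d} {p : Fin m → Point d} → AffinelyIndependent p →
  ∀ {F : Subset m} {i} → InHull p F (p i) → i ∈ F
vertex∈hull⇒∈ {p = p} indep {F} {i} (c , _ , c-supp , Σc≡1 , p≡c·p) =
  decidable-stable (i ∈? F) λ i∉F → 1≢0 (trans (sym cᵢ≡1) (c-supp i i∉F))
  where
  Σc≡Σδᵢ : sum c ≡ sum (δ i)
  Σc≡Σδᵢ = begin
    sum c       ≡⟨ sumℚ≡sum c ⟨
    sumℚ c      ≡⟨ Σc≡1 ⟩
    1ℚ          ≡⟨ sum-δ i ⟨
    sum (δ i)   ∎
  c·p≡δᵢ·p : ∀ k → lincomb c p k ≡ lincomb (δ i) p k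
  c·p≡δᵢ·p k = begin
    lincomb c p k                 ≡⟨ sumℚ≡sum (λ j → c j * p j k) ⟨
    sumℚ (λ j → c j * p j k)      ≡⟨ p≡c·p k ⟨
    p i k                         ≡⟨ sum-δ-* i (λ j → p j k) ⟨
    lincomb (δ i) p k             ∎
  cᵢ≡1 : c i ≡ 1ℚ
  cᵢ≡1 = trans (affineCombination-injective indep Σc≡Σδᵢ c·p≡δᵢ·p i) (δ-diag i)

differences-independent : ∀ {m d} {p : Fin m → Point d} → AffinelyIndependent p →
  ∀ (ρ : Fin m → Fin m) c → (∀ k → lincomb c (λ q k → p q k - p (ρ q) k) k ≡ 0ℚ) →
  ∀ q → (∀ q′ → ρ q′ ≢ q) → c q ≡ 0ℚ
differences-independent {p = p} indep ρ c c·Δ≡0 q q∉im =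
  trans (affineCombination-injective indep (sym (sum-push ρ c)) c·p≡push·p q) (push-outsideImage ρ c q∉im)
  where
  c·p≡push·p : ∀ k → lincomb c p k ≡ lincomb (push ρ c) p k
  c·p≡push·p k = begin
    lincomb c p k            ≡⟨ x∙y⁻¹≈ε⇒x≈y _ _ (trans (sym (lincomb-subʳ c p (p ∘ ρ) k)) (c·Δ≡0 k)) ⟩
    lincomb c (p ∘ ρ) k      ≡⟨ sum-push-* ρ c (λ l → p l k) ⟨
    lincomb (push ρ c) p k   ∎

SupportedIn : ∀ {m d} → (Fin m → Point d) → Subset m → Subset d → Set
SupportedIn x M F = ∀ i k → i ∈ M → k ∉ F → x i k ≡ 0ℚ

record LinearDependency {m d} (x : Fin m → Point d) (M : Subset m) : Set where
  field
    coeff         : Fin m → ℚ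
    coeff-outside : ∀ i → i ∉ M → coeff i ≡ 0ℚ
    nonzeroAt     : Fin m
    nonzeroAt∈M   : nonzeroAt ∈ M
    coeff-nonzero : coeff nonzeroAt ≢ 0ℚ
    lincomb≡0     : ∀ k → lincomb coeff x k ≡ 0ℚ

module Elimination {m d} (x : Fin m → Point d) (r : Fin m) (k₀ : Fin d) .{{_ : NonZero (x r k₀)}} where

  a⁻¹ : ℚ
  a⁻¹ = 1/ x r k₀

  eliminated : Fin m → Point d
  eliminated i k = x i k - x i k₀ * a⁻¹ * x r k

  eliminated-supportedIn : ∀ {M F} → r ∈ M → SupportedIn x M F → SupportedIn eliminated (M ∖ r) (F ∖ k₀)
  eliminated-supportedIn {M} {F} r∈M supp i k i∈M∖r k∉F∖k₀ with k ≟ k₀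
  ... | yes refl = begin
    x i k₀ - x i k₀ * a⁻¹ * x r k₀    ≡⟨ cong (x i k₀ -_) (trans (*-assoc (x i k₀) a⁻¹ (x r k₀))
                                                          (cong (x i k₀ *_) (*-inverseˡ (x r k₀)))) ⟩
    x i k₀ - x i k₀ * 1ℚ              ≡⟨ solve 1 (λ u → u :- u :* con 1ℚ := con 0ℚ) refl (x i k₀) ⟩
    0ℚ                                ∎
  ... | no k≢k₀ = begin
    x i k - x i k₀ * a⁻¹ * x r k      ≡⟨ cong₂ (λ u v → u - x i k₀ * a⁻¹ * v)
                                                (supp i k i∈M k∉F) (supp r k r∈M k∉F) ⟩
    0ℚ - x i k₀ * a⁻¹ * 0ℚ            ≡⟨ solve 1 (λ t → con 0ℚ :- t :* con 0ℚ := con 0ℚ) refl (x i k₀ * a⁻¹) ⟩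
    0ℚ                                ∎
    where
    i∈M : i ∈ M
    i∈M = p─q⊆p M ⁅ r ⁆ i∈M∖r
    k∉F : k ∉ F
    k∉F k∈F = k∉F∖k₀ (x∈p∧x≢y⇒x∈p-y k∈F k≢k₀)

  lift : ∀ {M} → r ∈ M → LinearDependency eliminated (M ∖ r) → LinearDependency x M
  lift {M} r∈M D = record
    { coeff         = c
    ; coeff-outside = c-outside
    ; nonzeroAt     = nonzeroAt
    ; nonzeroAt∈M   = p─q⊆p M ⁅ r ⁆ nonzeroAt∈M
    ; coeff-nonzero = λ c≡0 → coeff-nonzero (trans (sym (c≡c′ (x∈p∖y⇒x≢y nonzeroAt∈M))) c≡0)
    ; lincomb≡0     = c·x≡0
    }
    where
    open LinearDependency D renaming (coeff to c′)
    L : Point d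
    L = lincomb c′ x
    t : ℚ
    t = L k₀ * a⁻¹
    c : Fin m → ℚ
    c i = c′ i - δ r i * t
    c≡c′ : ∀ {i} → i ≢ r → c i ≡ c′ i
    c≡c′ {i} i≢r = begin
      c′ i - δ r i * t   ≡⟨ cong (λ u → c′ i - u * t) (δ-off r i (i≢r ∘ sym)) ⟩
      c′ i - 0ℚ * t      ≡⟨ solve 2 (λ u t → u :- con 0ℚ :* t := u) refl (c′ i) t ⟩
      c′ i               ∎
    c-outside : ∀ i → i ∉ M → c i ≡ 0ℚ
    c-outside i i∉M = trans (c≡c′ λ { refl → i∉M r∈M }) (coeff-outside i (i∉M ∘ p─q⊆p M ⁅ r ⁆))
    c·x : ∀ k → lincomb c x k ≡ L k - x r k * t
    c·x k = begin
      lincomb c x k                                ≡⟨ sum-cong-≗ (λ i → expand (c′ i) (δ r i) t (x i k)) ⟩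
      sum (λ i → c′ i * x i k - δ r i * x i k * t) ≡⟨ sum-sub-* (λ i → c′ i * x i k) (λ i → δ r i * x i k) t ⟩
      L k - sum (λ i → δ r i * x i k) * t          ≡⟨ cong (λ u → L k - u * t) (sum-δ-* r (λ i → x i k)) ⟩
      L k - x r k * t                              ∎
      where
      expand : ∀ u v t w → (u - v * t) * w ≡ u * w - v * w * t
      expand = solve 4 (λ u v t w → (u :- v :* t) :* w := u :* w :- v :* w :* t) refl
    c′·eliminated : ∀ k → lincomb c′ eliminated k ≡ L k - L k₀ * (a⁻¹ * x r k)
    c′·eliminated k = begin
      lincomb c′ eliminated k
        ≡⟨ sum-cong-≗ (λ i → expand (c′ i) (x i k) (x i k₀) a⁻¹ (x r k)) ⟩
      sum (λ i → c′ i * x i k - c′ i * x i k₀ * (a⁻¹ * x r k))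
        ≡⟨ sum-sub-* (λ i → c′ i * x i k) (λ i → c′ i * x i k₀) (a⁻¹ * x r k) ⟩
      L k - L k₀ * (a⁻¹ * x r k)
        ∎
      where
      expand : ∀ u v v₀ a w → u * (v - v₀ * a * w) ≡ u * v - u * v₀ * (a * w)
      expand = solve 5 (λ u v v₀ a w → u :* (v :- v₀ :* a :* w) := u :* v :- u :* v₀ :* (a :* w)) refl
    c·x≡0 : ∀ k → lincomb c x k ≡ 0ℚ
    c·x≡0 k = begin
      lincomb c x k                ≡⟨ c·x k ⟩
      L k - x r k * t              ≡⟨ solve 4 (λ l l₀ a w → l :- w :* (l₀ :* a) := l :- l₀ :* (a :* w))
                                            refl (L k) (L k₀) a⁻¹ (x r k) ⟩
      L k - L k₀ * (a⁻¹ * x r k)   ≡⟨ c′·eliminated k ⟨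
      lincomb c′ eliminated k      ≡⟨ lincomb≡0 k ⟩
      0ℚ                           ∎

zeroColumn-supportedIn : ∀ {m d} {x : Fin m → Point d} {M F k₀} → SupportedIn x M F →
  (∀ i → i ∈ M → x i k₀ ≡ 0ℚ) → SupportedIn x M (F ∖ k₀)
zeroColumn-supportedIn {k₀ = k₀} supp column≡0 i k i∈M k∉F∖k₀ with k ≟ k₀
... | yes refl = column≡0 i i∈M
... | no k≢k₀  = supp i k i∈M (λ k∈F → k∉F∖k₀ (x∈p∧x≢y⇒x∈p-y k∈F k≢k₀))

linearDependency : ∀ n {m d} {x : Fin m → Point d} {M : Subset m} {F : Subset d} →
  ∣ F ∣ ≡ n → n < ∣ M ∣ → SupportedIn x M F → LinearDependency x M
linearDependency zero {x = x} {M} ∣F∣≡0 0<∣M∣ supp = record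
  { coeff         = δ q
  ; coeff-outside = λ i i∉M → δ-off q i λ { refl → i∉M q∈M }
  ; nonzeroAt     = q
  ; nonzeroAt∈M   = q∈M
  ; coeff-nonzero = λ δqq≡0 → 1≢0 (trans (sym (δ-diag q)) δqq≡0)
  ; lincomb≡0     = λ k → trans (sum-δ-* q (λ i → x i k)) (supp q k q∈M (∣p∣≡0⇒x∉p ∣F∣≡0))
  }
  where
  q = proj₁ (∣p∣>0⇒Nonempty M 0<∣M∣)
  q∈M = proj₂ (∣p∣>0⇒Nonempty M 0<∣M∣)
linearDependency (suc n) {x = x} {M} {F} ∣F∣≡1+n 1+n<∣M∣ supp
  with (k₀ , k₀∈F) ← ∣p∣>0⇒Nonempty F (subst (0 <_) (sym ∣F∣≡1+n) (ℕ.s≤s ℕ.z≤n))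
  with ∣F∖k₀∣≡n ← suc-injective (trans (sym (x∈p⇒∣p∣≡1+∣p∖x∣ k₀∈F)) ∣F∣≡1+n)
  with any? (λ r → (r ∈? M) ×-dec ¬? (x r k₀ ≟ℚ 0ℚ))
... | no noPivot =
  linearDependency n ∣F∖k₀∣≡n (<-trans (n<1+n n) 1+n<∣M∣) (zeroColumn-supportedIn supp column≡0)
  where
  column≡0 : ∀ i → i ∈ M → x i k₀ ≡ 0ℚ
  column≡0 i i∈M = decidable-stable (x i k₀ ≟ℚ 0ℚ) λ ≢0 → noPivot (i , i∈M , ≢0)
... | yes (r , r∈M , pivot≢0) =
  lift r∈M (linearDependency n ∣F∖k₀∣≡n (≤-pred (subst (suc n <_) (x∈p⇒∣p∣≡1+∣p∖x∣ r∈M) 1+n<∣M∣))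
                             (eliminated-supportedIn r∈M supp))
  where
  instance
    pivot-nonZero : NonZero (x r k₀)
    pivot-nonZero = ≢-nonZero pivot≢0
  open Elimination x r k₀

bℚ-injective : ∀ {a b} → bℚ a ≡ bℚ b → a ≡ b
bℚ-injective {false} {false} _ = refl
bℚ-injective {true}  {true}  _ = refl
bℚ-injective {false} {true}  ()
bℚ-injective {true}  {false} ()

weighted-xor≡0 : ∀ {w} a b → w ≢ 0ℚ → w * bℚ (a xor b) ≡ 0ℚ → b ≡ a
weighted-xor≡0 false false _ _ = refl
weighted-xor≡0 true  true  _ _ = refl
weighted-xor≡0 {w} false true  w≢0 w≡0 = ⊥-elim (w≢0 (trans (sym (*-identityʳ w)) w≡0))
weighted-xor≡0 {w} true  false w≢0 w≡0 = ⊥-elim (w≢0 (trans (sym (*-identityʳ w)) w≡0))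

sum-xor-weights : ∀ {m} {c : Fin m → ℚ} (v : Fin m → Bool) a → sum c ≡ 1ℚ →
  sum (λ i → c i * bℚ (v i)) ≡ bℚ a → sum (λ i → c i * bℚ (a xor v i)) ≡ 0ℚ
sum-xor-weights v false _ Σcv≡0 = Σcv≡0
sum-xor-weights {c = c} v true Σc≡1 Σcv≡1 = begin
  sum (λ i → c i * bℚ (not (v i)))     ≡⟨ sum-cong-≗ (λ i → weight-not (c i) (v i)) ⟩
  sum (λ i → c i - c i * bℚ (v i))     ≡⟨ sum-sub c (λ i → c i * bℚ (v i)) ⟩
  sum c - sum (λ i → c i * bℚ (v i))   ≡⟨ cong₂ _-_ Σc≡1 Σcv≡1 ⟩
  1ℚ - 1ℚ                              ≡⟨ +-inverseʳ 1ℚ ⟩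
  0ℚ                                   ∎
  where
  weight-not : ∀ w b → w * bℚ (not b) ≡ w - w * bℚ b
  weight-not w false = solve 1 (λ w → w :* con 1ℚ := w :- w :* con 0ℚ) refl w
  weight-not w true  = solve 1 (λ w → w :* con 0ℚ := w :- w :* con 1ℚ) refl w

convexCombination-bits : ∀ {m} {c : Fin m → ℚ} (v : Fin m → Bool) a → (∀ i → 0ℚ ≤ c i) → sum c ≡ 1ℚ →
  sum (λ i → c i * bℚ (v i)) ≡ bℚ a → ∀ i → c i ≢ 0ℚ → v i ≡ a
convexCombination-bits {c = c} v a c≥0 Σc≡1 Σcv≡a i cᵢ≢0 =
  weighted-xor≡0 a (v i) cᵢ≢0 (nonneg-sum≡0 weight≥0 (sum-xor-weights v a Σc≡1 Σcv≡a) i)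
  where
  weight≥0 : ∀ j → 0ℚ ≤ c j * bℚ (a xor v j)
  weight≥0 j with a xor v j
  ... | false = subst (0ℚ ≤_) (sym (*-zeroʳ (c j))) ≤-refl
  ... | true  = subst (0ℚ ≤_) (sym (*-identityʳ (c j))) (c≥0 j)

nonzeroCoefficient : ∀ {m} (c : Fin m → ℚ) → sum c ≢ 0ℚ → ∃ λ j → c j ≢ 0ℚ
nonzeroCoefficient {m} c Σc≢0 = ¬∀⟶∃¬ m (λ j → c j ≡ 0ℚ) (λ j → c j ≟ℚ 0ℚ) (Σc≢0 ∘ sum-zero)

AgreeOn : ∀ {d} {A : Set} → Subset d → (Fin d → A) → (Fin d → A) → Set
AgreeOn C u w = ∀ k → k ∈ C → u k ≡ w k

hull-agreeOn : ∀ {m d} (v : Fin m → CubeVertex d) {τ : Subset m} {x : Point d} {C : Subset d} {w} →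
  InHull (λ i → embed (v i)) τ x → AgreeOn C x (embed w) → ∃ λ j → j ∈ τ × AgreeOn C (v j) w
hull-agreeOn v {τ} {x} {C} {w} (c , c≥0 , c-supp , Σc≡1 , x≡c·v) x≈w =
  j , decidable-stable (j ∈? τ) (cⱼ≢0 ∘ c-supp j) , vⱼ≈w
  where
  Σc≡1′ : sum c ≡ 1ℚ
  Σc≡1′ = trans (sym (sumℚ≡sum c)) Σc≡1
  nonzero : ∃ λ j → c j ≢ 0ℚ
  nonzero = nonzeroCoefficient c λ Σc≡0 → 1≢0 (trans (sym Σc≡1′) Σc≡0)
  j = proj₁ nonzero
  cⱼ≢0 = proj₂ nonzero
  vⱼ≈w : AgreeOn C (v j) w
  vⱼ≈w k k∈C = convexCombination-bits (λ l → v l k) (w k) c≥0 Σc≡1′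
    (trans (sym (trans (x≡c·v k) (sumℚ≡sum (λ l → c l * embed (v l) k)))) (x≈w k k∈C)) j cⱼ≢0

InS? : ∀ {d} (α : Simplex d) (σ : Subset (suc d)) (k : Fin d) → Dec (InS α σ k)
InS? α σ k = any? λ i → any? λ i′ → (i ∈? σ) ×-dec (i′ ∈? σ) ×-dec ¬? (vert α i k ≟𝔹 vert α i′ k)

project : ∀ {d} → Simplex d → Subset (suc d) → Point d → Point d
project α σ x k with InS? α σ k
... | yes _ = 0ℚ
... | no  _ = x k

project-IsProj : ∀ {d} (α : Simplex d) (σ : Subset (suc d)) (x : Point d) → IsProj α σ x (project α σ x)
project-IsProj α σ x k with InS? α σ k
... | yes k∈S = (λ _ → refl) , λ k∉S → ⊥-elim (k∉S k∈S)
... | no  k∉S = (λ k∈S → ⊥-elim (k∉S k∈S)) , λ _ → refl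

OnFace : ∀ {d} → Simplex d → Subset (suc d) → Subset d → CubeVertex d → Set
OnFace α σ C b = ∀ s → s ∈ σ → AgreeOn C (vert α s) b

ExteriorFace⇒OnFace : ∀ {d j} (α : Simplex d) {σ : Subset (suc d)} → ExteriorFace α j σ →
  ∃₂ λ C b → ∣ ∁ C ∣ < ∣ σ ∣ × OnFace α σ C b
ExteriorFace⇒OnFace {d} {j} α {σ} (∣σ∣≡1+j , C , b , ∣C∣≡d∸j , σ⊆face) = C , b , ∣∁C∣<∣σ∣ , σ-onFace
  where
  j≤d : j ℕ.≤ d
  j≤d = ≤-pred (subst (ℕ._≤ suc d) ∣σ∣≡1+j (∣p∣≤n σ))
  ∣∁C∣≡j : ∣ ∁ C ∣ ≡ j
  ∣∁C∣≡j = trans (∣∁p∣≡n∸∣p∣ C) (trans (cong (d ℕ.∸_) ∣C∣≡d∸j) (m∸[m∸n]≡n j≤d))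
  ∣∁C∣<∣σ∣ : ∣ ∁ C ∣ < ∣ σ ∣
  ∣∁C∣<∣σ∣ = subst₂ _<_ (sym ∣∁C∣≡j) (sym ∣σ∣≡1+j) (n<1+n j)
  σ-onFace : OnFace α σ C b
  σ-onFace s s∈σ k k∈C = bℚ-injective (proj₂ (σ⊆face (vpts α s) (vertex∈hull (vpts α) s∈σ)) k k∈C)

module _ {d} (α : Simplex d) {σ : Subset (suc d)} {C : Subset d} {b : CubeVertex d}
         (∣∁C∣<∣σ∣ : ∣ ∁ C ∣ < ∣ σ ∣) (σ-onFace : OnFace α σ C b) where

  agreeOnFace⇒≡ : ∀ {i j} → i ∉ σ → AgreeOn C (vert α j) (vert α i) → j ≡ i
  agreeOnFace⇒≡ {i} {j} i∉σ j≈i = decidable-stable (j ≟ i) ¬j≢i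
    where
    -- Taking r = j when j ∈ σ ensures that ρ, whose values are j and r, never hits nonzeroAt ∈ M.
    reference : ∃ λ r → r ∈ σ × (j ∈ σ → j ≡ r)
    reference with j ∈? σ
    ... | yes j∈σ = j , j∈σ , λ _ → refl
    ... | no  j∉σ = proj₁ σ≠∅ , proj₂ σ≠∅ , λ j∈σ → ⊥-elim (j∉σ j∈σ)
      where σ≠∅ = ∣p∣>0⇒Nonempty σ (≤-<-trans ℕ.z≤n ∣∁C∣<∣σ∣)
    r = proj₁ reference
    r∈σ = proj₁ (proj₂ reference)
    j∈σ⇒j≡r = proj₂ (proj₂ reference)

    ρ : Fin (suc d) → Fin (suc d)
    ρ q = if does (q ≟ i) then j else r

    Δ : Fin (suc d) → Point d
    Δ q k = vpts α q k - vpts α (ρ q) k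

    M : Subset (suc d)
    M = (σ ∪ ⁅ i ⁆) ∖ r

    Δ-supportedIn : SupportedIn Δ M (∁ C)
    Δ-supportedIn q k q∈M k∉∁C with q ≟ i
    ... | yes refl = x≈y⇒x∙y⁻¹≈ε (cong bℚ (sym (j≈i k (x∉∁p⇒x∈p k∉∁C))))
    ... | no  q≢i  = x≈y⇒x∙y⁻¹≈ε (cong bℚ (trans (σ-onFace q q∈σ k k∈C) (sym (σ-onFace r r∈σ k k∈C))))
      where
      k∈C = x∉∁p⇒x∈p k∉∁C
      q∈σ : q ∈ σ
      q∈σ with x∈p∪q⁻ σ ⁅ i ⁆ (p─q⊆p _ _ q∈M)
      ... | inj₁ q∈σ = q∈σ
      ... | inj₂ q∈⁅i⁆ = ⊥-elim (q≢i (x∈⁅y⁆⇒x≡y i q∈⁅i⁆))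

    open LinearDependency
      (linearDependency _ refl (<-≤-trans ∣∁C∣<∣σ∣ (∣p∣≤∣p∪⁅x⁆∖y∣ i∉σ r∈σ)) Δ-supportedIn)

    q≢r : nonzeroAt ≢ r
    q≢r = x∈p∖y⇒x≢y nonzeroAt∈M

    ¬j≢i : ¬ j ≢ i
    ¬j≢i j≢i = coeff-nonzero (differences-independent {p = vpts α} (affind α) ρ coeff lincomb≡0 nonzeroAt ρ≢q)
      where
      q≢j : nonzeroAt ≢ j
      q≢j q≡j with x∈p∪q⁻ σ ⁅ i ⁆ (p─q⊆p _ _ nonzeroAt∈M)
      ... | inj₁ q∈σ   = q≢r (trans q≡j (j∈σ⇒j≡r (subst (_∈ σ) q≡j q∈σ)))
      ... | inj₂ q∈⁅i⁆ = j≢i (trans (sym q≡j) (x∈⁅y⁆⇒x≡y i q∈⁅i⁆))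
      ρ≢q : ∀ q′ → ρ q′ ≢ nonzeroAt
      ρ≢q q′ with q′ ≟ i
      ... | yes _ = q≢j ∘ sym
      ... | no  _ = q≢r ∘ sym

  ∈C⇒∉S : ∀ {k} → k ∈ C → ¬ InS α σ k
  ∈C⇒∉S k∈C (s , s′ , s∈σ , s′∈σ , vₛ≢vₛ′) =
    vₛ≢vₛ′ (trans (σ-onFace s s∈σ _ k∈C) (sym (σ-onFace s′ s′∈σ _ k∈C)))

  shadow⊆⇒∈ : ∀ {τ τ′} → (∀ y → Shadow α σ τ y → Shadow α σ τ′ y) → ∀ {i} → i ∉ σ → i ∈ τ → i ∈ τ′
  shadow⊆⇒∈ {τ} {τ′} sh⊆ {i} i∉σ i∈τ =
    subst (_∈ τ′) (agreeOnFace⇒≡ i∉σ (proj₂ (proj₂ agreeing))) (proj₁ (proj₂ agreeing))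
    where
    vᵢ : Point d
    vᵢ = vpts α i
    πvᵢ∈Shadowτ′ : Shadow α σ τ′ (project α σ vᵢ)
    πvᵢ∈Shadowτ′ = sh⊆ _ (vᵢ , vertex∈hull (vpts α) i∈τ , project-IsProj α σ vᵢ)
    x′ = proj₁ πvᵢ∈Shadowτ′
    x′≈vᵢ : AgreeOn C x′ vᵢ
    x′≈vᵢ k k∈C = trans (sym (proj₂ (proj₂ (proj₂ πvᵢ∈Shadowτ′) k) (∈C⇒∉S k∈C)))
                        (proj₂ (project-IsProj α σ vᵢ k) (∈C⇒∉S k∈C))
    agreeing : ∃ λ j → j ∈ τ′ × AgreeOn C (vert α j) (vert α i)
    agreeing = hull-agreeOn (vert α) (proj₁ (proj₂ πvᵢ∈Shadowτ′)) x′≈vᵢ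

footprint⊆⇒∈ : ∀ {d} (α : Simplex d) {σ τ τ′ : Subset (suc d)} →
  (∀ x → Footprint α σ τ x → Footprint α σ τ′ x) → ∀ {i} → i ∈ σ → i ∈ τ → i ∈ τ′
footprint⊆⇒∈ α fp⊆ i∈σ i∈τ =
  vertex∈hull⇒∈ {p = vpts α} (affind α) (proj₁ (fp⊆ _ (vertex∈hull (vpts α) i∈τ , vertex∈hull (vpts α) i∈σ)))

footprint-shadow⇒⊆ : ∀ {d d′} (α : Simplex d) {σ τ τ′ : Subset (suc d)} → ExteriorFace α d′ σ →
  (∀ x → Footprint α σ τ x → Footprint α σ τ′ x) → (∀ y → Shadow α σ τ y → Shadow α σ τ′ y) → τ ⊆ τ′
footprint-shadow⇒⊆ α {σ} exσ fp⊆ sh⊆ {i} i∈τ with i ∈? σ | ExteriorFace⇒OnFace α exσ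
... | yes i∈σ | _ = footprint⊆⇒∈ α fp⊆ i∈σ i∈τ
... | no  i∉σ | (_ , _ , ∣∁C∣<∣σ∣ , σ-onFace) = shadow⊆⇒∈ α ∣∁C∣<∣σ∣ σ-onFace sh⊆ i∉σ i∈τ

mainTheorem13 : (d d' : ℕ) (α : Simplex d) (σ τ τ' : Subset (suc d)) →
    ExteriorFace α d' σ → ExteriorFace α d' τ → ExteriorFace α d' τ' →
    SameSet (Footprint α σ τ) (Footprint α σ τ') →
    SameSet (Shadow α σ τ) (Shadow α σ τ') →
    τ ≡ τ'
mainTheorem13 d d' α σ τ τ' exσ _ _ (fp⊆ , fp⊇) (sh⊆ , sh⊇) =
  ⊆-antisym (footprint-shadow⇒⊆ α exσ fp⊆ sh⊆) (footprint-shadow⇒⊆ α exσ fp⊇ sh⊇)
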